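{- Let $\mathcal{T}(X_0)$ be a discrete generation pedigree of order $n > 2$. If there are two distinct vertices $x_i, x_j \in X_0$ that have the same two parents, then $\mathcal{T}(X_0)$ is uniquely determined by $S_{n-1}(\mathcal{T})$: every pedigree $\mathcal{U}(X_0)$ that is $(n-1)$-hypomorphic to $\mathcal{T}(X_0)$ is isomorphic to $\mathcal{T}(X_0)$ via an isomorphism fixing every vertex of $X_0$.
   Context: A pedigree $\mathcal{T}(X_0)$ on a set $X_0$ is a finite directed graph (no loops, no multiple arcs) on a vertex set $V$ such that every vertex has out-degree $0$ or $2$, $X_0 \subseteq V$ consists of vertices of in-degree $0$ (called extant), and there are no isolated vertices; $|X_0|$ is its order. If $uv$ is an arc, $v$ is a parent of $u$. A discrete generation pedigree is one whose vertex set is a disjoint union $X_0 \cup X_1 \cup \dots \cup X_d$, where $X_d$ is the set of vertices of out-degree $0$ and each vertex of $X_i$, $i<d$, has its two parents in $X_{i+1}$. A vertex $v$ is a descendant of $u$ if there is a directed path from $v$ to $u$ (including $v=u$). For $Y \subseteq X_0$, the sub-pedigree $\mathcal{T}(Y)$ is obtained by deleting every vertex with no descendant in $Y$. Isomorphisms of pedigrees are arc-preserving bijections (in both directions) fixing each labelled extant vertex; other vertices are unlabelled. $S_{n-1}(\mathcal{T}) = \{\mathcal{T}(Y) : Y \subset X_0, |Y| = n-1\}$, each given up to such isomorphism. Two pedigrees $\mathcal{T}(X_0), \mathcal{U}(X_0)$ of order $n$ are $(n-1)$-hypomorphic if for every $Y \subset X_0$ with $|Y|=n-1$ there is an isomorphism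 $\mathcal{T}(Y) \to \mathcal{U}(Y)$ fixing each vertex of $Y$. -}

module Defs where

open import Data.Nat using (ℕ; zero; suc; _+_; _≤_)
open import Data.Fin using (Fin; zero; suc)
open import Data.Bool using (Bool; true; false; if_then_else_)
open import Data.Product using (Σ; ∃; _×_; _,_)
open import Data.Sum using (_⊎_)
open import Data.Unit using (⊤)
open import Relation.Binary.PropositionalEquality using (_≡_; _≢_)

countTrue : ∀ {k} → (Fin k → Bool) → ℕ
countTrue {zero}  p = 0
countTrue {suc k} p = (if p zero then 1 else 0) + countTrue (λ i → p (suc i))

-- A pedigree on the labelled extant set X₀ = {ext i | i : Fin n}.
-- Vertices are Fin size; arc u v ≡ true means there is an arc uv,
-- i.e. v is a parent of u.  Being Bool-valued, there are no multiple arcs.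
record Pedigree (n : ℕ) : Set where
  field
    size       : ℕ
    arc        : Fin size → Fin size → Bool
    noLoop     : ∀ u → arc u u ≡ false
    outDeg02   : ∀ u → countTrue (arc u) ≡ 0 ⊎ countTrue (arc u) ≡ 2
    ext        : Fin n → Fin size
    extInj     : ∀ i j → ext i ≡ ext j → i ≡ j
    extInDeg0  : ∀ i u → arc u (ext i) ≡ false
    noIsolated : ∀ v → ∃ λ u → arc u v ≡ true ⊎ arc v u ≡ true

  outDeg : Fin size → ℕ
  outDeg u = countTrue (arc u)

open Pedigree public

record DiscreteGeneration {n : ℕ} (T : Pedigree n) : Set where
  field
    d      : ℕ
    gen    : Fin (size T) → ℕ
    genLe  : ∀ v → gen v ≤ d
    gen0   : ∀ v → gen v ≡ 0 → ∃ λ i → ext T i ≡ v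
    ext0   : ∀ i → gen (ext T i) ≡ 0
    genD⇒  : ∀ v → gen v ≡ d → outDeg T v ≡ 0
    ⇒genD  : ∀ v → outDeg T v ≡ 0 → gen v ≡ d
    genArc : ∀ u v → arc T u v ≡ true → gen v ≡ suc (gen u)

-- Reach T a b : there is a directed path from a to b
-- (i.e. a is a descendant of b; includes a = b).
data Reach {n : ℕ} (T : Pedigree n) : Fin (size T) → Fin (size T) → Set where
  here  : ∀ {a} → Reach T a a
  there : ∀ {a c b} → arc T a c ≡ true → Reach T c b → Reach T a b

-- Vertices of the sub-pedigree T(Y), Y ⊆ X₀ given by a predicate on labels:
-- those having a descendant in Y.
Kept : ∀ {n} (T : Pedigree n) → (Fin n → Set) → Fin (size T) → Set
Kept T Y v = ∃ λ i → Y i × Reach T (ext T i) v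

-- An isomorphism T(Y) → U(Y) fixing each vertex of Y: mutually inverse maps
-- between the vertex sets of the two sub-pedigrees, preserving arcs
-- (arc-preservation of the inverse follows from bijectivity), and sending the
-- extant vertex labelled i in T to the one labelled i in U, for i ∈ Y.
record SubIso {n : ℕ} (T U : Pedigree n) (Y : Fin n → Set) : Set where
  field
    to      : Fin (size T) → Fin (size U)
    from    : Fin (size U) → Fin (size T)
    toKept  : ∀ v → Kept T Y v → Kept U Y (to v)
    fromKept : ∀ w → Kept U Y w → Kept T Y (from w)
    fromTo  : ∀ v → Kept T Y v → from (to v) ≡ v
    toFrom  : ∀ w → Kept U Y w → to (from w) ≡ w
    arcPres : ∀ u v → Kept T Y u → Kept T Y v → arc T u v ≡ arc U (to u) (to v)
    fixExt  : ∀ i → Y i → to (ext T i) ≡ ext U i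

Hypomorphic : ∀ {n} → Pedigree n → Pedigree n → Set
Hypomorphic {n} T U = ∀ (k : Fin n) → SubIso T U (λ i → i ≢ k)

IsoX0 : ∀ {n} → Pedigree n → Pedigree n → Set
IsoX0 T U = SubIso T U (λ _ → ⊤)

-- First, the sibling relation transfers to any hypomorphic U: deleting a third
-- extant vertex x_k keeps both x_i and x_j and their parents, and the isomorphism
-- T(X₀ ∖ x_k) ≅ U(X₀ ∖ x_k) fixes x_i and x_j.  Second, in both pedigrees every
-- vertex other than x_i still has a descendant in X₀ ∖ x_i (replace x_i by x_j),
-- so the isomorphism T(X₀ ∖ x_i) ≅ U(X₀ ∖ x_i) extends to all of T by x_i ↦ x_i,
-- the arcs out of x_i being copies of those out of x_j.
module Submission where

open import Defs
open import Data.Nat using (ℕ; suc; _<_; s≤s)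
open import Data.Fin using (Fin; zero; suc; _≟_)
open import Data.Bool using (true; false)
open import Data.Product using (∃; _×_; _,_)
open import Data.Unit using (⊤; tt)
open import Data.Empty using (⊥-elim)
open import Relation.Nullary using (yes; no; ¬_)
open import Relation.Binary.PropositionalEquality

Everyone : ∀ {n} → Fin n → Set
Everyone _ = ⊤

AllBut : ∀ {n} → Fin n → Fin n → Set
AllBut k i = i ≢ k

Siblings : ∀ {n} (P : Pedigree n) → Fin n → Fin n → Set
Siblings P i j = ∀ v → arc P (ext P i) v ≡ arc P (ext P j) v

third-element : ∀ {n} → 2 < n → (i j : Fin n) → ∃ λ k → i ≢ k × j ≢ k
third-element {suc (suc (suc _))} (s≤s (s≤s (s≤s _))) i j with i ≟ zero | j ≟ zero
... | no i≢0 | no j≢0 = zero , i≢0 , j≢0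
... | yes refl | _ with j ≟ suc zero
...   | no j≢1   = suc zero , (λ ()) , j≢1
...   | yes refl = suc (suc zero) , (λ ()) , (λ ())
third-element {suc (suc (suc _))} (s≤s (s≤s (s≤s _))) i j | no _ | yes refl with i ≟ suc zero
...   | no i≢1   = suc zero , i≢1 , (λ ())
...   | yes refl = suc (suc zero) , (λ ()) , (λ ())

true≢false : true ≢ false
true≢false ()

module _ {n} (P : Pedigree n) where

  reach-ext⇒≡ : ∀ {u b} → Reach P u (ext P b) → u ≡ ext P b
  reach-ext⇒≡ here = refl
  reach-ext⇒≡ (there {a = u} u→c c⇝b) with reach-ext⇒≡ c⇝b
  ... | refl = ⊥-elim (true≢false (trans (sym u→c) (extInDeg0 P _ u)))

  ext-not-kept-by-others : ∀ i → ¬ Kept P (AllBut i) (ext P i)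
  ext-not-kept-by-others i (a , a≢i , a⇝i) = a≢i (extInj P a i (reach-ext⇒≡ a⇝i))

  kept-by-everyone : ∀ {Y} v → Kept P Y v → Kept P Everyone v
  kept-by-everyone v (a , _ , a⇝v) = a , tt , a⇝v

  kept-without-sibling : ∀ {i j} → i ≢ j → Siblings P i j →
    ∀ v → Kept P Everyone v → v ≢ ext P i → Kept P (AllBut i) v
  kept-without-sibling {i} {j} i≢j sib v (a , _ , a⇝v) v≢i with a ≟ i
  ... | no a≢i = a , a≢i , a⇝v
  ... | yes refl with a⇝v
  ...   | here           = ⊥-elim (v≢i refl)
  ...   | there i→c c⇝v = j , (λ j≡i → i≢j (sym j≡i)) , there (trans (sym (sib _)) i→c) c⇝v

siblings-transfer : ∀ {n} {T U : Pedigree n} {Y i j} → SubIso T U Y → Y i → Y j →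
  Siblings T i j → Siblings U i j
siblings-transfer {T = T} {U} {Y} {i} {j} σ Yi Yj sib w = on-values _ refl _ refl
  where
  open SubIso σ
  open ≡-Reasoning

  on-kept : Kept U Y w → arc U (ext U i) w ≡ arc U (ext U j) w
  on-kept kw = begin
      arc U (ext U i) w
    ≡⟨ cong₂ (arc U) (sym (fixExt i Yi)) (sym (toFrom w kw)) ⟩
      arc U (to (ext T i)) (to (from w))
    ≡⟨ sym (arcPres _ _ (i , Yi , here) (fromKept w kw)) ⟩
      arc T (ext T i) (from w)
    ≡⟨ sib _ ⟩
      arc T (ext T j) (from w)
    ≡⟨ arcPres _ _ (j , Yj , here) (fromKept w kw) ⟩
      arc U (to (ext T j)) (to (from w))
    ≡⟨ cong₂ (arc U) (fixExt j Yj) (toFrom w kw) ⟩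
      arc U (ext U j) w
    ∎

  -- A parent w of x_i or x_j in U is kept, having x_i or x_j as descendant.
  on-values : ∀ b → arc U (ext U i) w ≡ b → ∀ c → arc U (ext U j) w ≡ c → b ≡ c
  on-values true  i→w c     eqc = trans (sym i→w) (trans (on-kept (i , Yi , there i→w here)) eqc)
  on-values false eqb true  j→w = trans (sym eqb) (trans (on-kept (j , Yj , there j→w here)) j→w)
  on-values false _   false _   = refl

module ExtendAcrossSibling {n} {T U : Pedigree n} {i j : Fin n} (i≢j : i ≢ j)
  (sibT : Siblings T i j) (sibU : Siblings U i j) (σ : SubIso T U (AllBut i)) where

  open SubIso σ

  j≢i : j ≢ i
  j≢i j≡i = i≢j (sym j≡i)

  keptT : ∀ v → Kept T Everyone v → v ≢ ext T i → Kept T (AllBut i) v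
  keptT = kept-without-sibling T i≢j sibT

  keptU : ∀ w → Kept U Everyone w → w ≢ ext U i → Kept U (AllBut i) w
  keptU = kept-without-sibling U i≢j sibU

  to′ : Fin (size T) → Fin (size U)
  to′ v with v ≟ ext T i
  ... | yes _ = ext U i
  ... | no _  = to v

  from′ : Fin (size U) → Fin (size T)
  from′ w with w ≟ ext U i
  ... | yes _ = ext T i
  ... | no _  = from w

  toKept′ : ∀ v → Kept T Everyone v → Kept U Everyone (to′ v)
  toKept′ v kv with v ≟ ext T i
  ... | yes _   = i , tt , here
  ... | no v≢i = kept-by-everyone U _ (toKept v (keptT v kv v≢i))

  fromKept′ : ∀ w → Kept U Everyone w → Kept T Everyone (from′ w)
  fromKept′ w kw with w ≟ ext U i
  ... | yes _   = i , tt , here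
  ... | no w≢i = kept-by-everyone T _ (fromKept w (keptU w kw w≢i))

  fromTo′ : ∀ v → Kept T Everyone v → from′ (to′ v) ≡ v
  fromTo′ v kv with v ≟ ext T i
  ... | yes refl with ext U i ≟ ext U i
  ...   | yes _ = refl
  ...   | no ne = ⊥-elim (ne refl)
  fromTo′ v kv | no v≢i with to v ≟ ext U i
  ...   | yes eq = ⊥-elim (ext-not-kept-by-others U i (subst (Kept U (AllBut i)) eq (toKept v (keptT v kv v≢i))))
  ...   | no _   = fromTo v (keptT v kv v≢i)

  toFrom′ : ∀ w → Kept U Everyone w → to′ (from′ w) ≡ w
  toFrom′ w kw with w ≟ ext U i
  ... | yes refl with ext T i ≟ ext T i
  ...   | yes _ = refl
  ...   | no ne = ⊥-elim (ne refl)
  toFrom′ w kw | no w≢i with from w ≟ ext T i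
  ...   | yes eq = ⊥-elim (ext-not-kept-by-others T i (subst (Kept T (AllBut i)) eq (fromKept w (keptU w kw w≢i))))
  ...   | no _   = toFrom w (keptU w kw w≢i)

  arcs-from-sibling : ∀ v → Kept T (AllBut i) v → arc T (ext T i) v ≡ arc U (ext U i) (to v)
  arcs-from-sibling v kv = begin
      arc T (ext T i) v             ≡⟨ sibT v ⟩
      arc T (ext T j) v             ≡⟨ arcPres _ _ (j , j≢i , here) kv ⟩
      arc U (to (ext T j)) (to v)   ≡⟨ cong (λ z → arc U z (to v)) (fixExt j j≢i) ⟩
      arc U (ext U j) (to v)        ≡⟨ sym (sibU _) ⟩
      arc U (ext U i) (to v)        ∎
    where open ≡-Reasoning

  arcPres′ : ∀ u v → Kept T Everyone u → Kept T Everyone v → arc T u v ≡ arc U (to′ u) (to′ v)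
  arcPres′ u v ku kv with u ≟ ext T i | v ≟ ext T i
  ... | yes refl | yes refl = trans (noLoop T _) (sym (noLoop U _))
  ... | yes refl | no v≢i   = arcs-from-sibling v (keptT v kv v≢i)
  ... | no _     | yes refl = trans (extInDeg0 T i u) (sym (extInDeg0 U i _))
  ... | no u≢i   | no v≢i   = arcPres u v (keptT u ku u≢i) (keptT v kv v≢i)

  fixExt′ : ∀ a → Everyone a → to′ (ext T a) ≡ ext U a
  fixExt′ a _ with ext T a ≟ ext T i
  ... | yes eq with extInj T a i eq
  ...   | refl = refl
  fixExt′ a _ | no ne = fixExt a (λ a≡i → ne (cong (ext T) a≡i))

  iso : IsoX0 T U
  iso = record
    { to = to′ ; from = from′ ; toKept = toKept′ ; fromKept = fromKept′
    ; fromTo = fromTo′ ; toFrom = toFrom′ ; arcPres = arcPres′ ; fixExt = fixExt′ }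

lemma1 : ∀ {n : ℕ} (T : Pedigree n) → DiscreteGeneration T → 2 < n →
    (i j : Fin n) → i ≢ j →
    outDeg T (ext T i) ≡ 2 →
    (∀ v → arc T (ext T i) v ≡ arc T (ext T j) v) →
    ∀ (U : Pedigree n) → Hypomorphic T U → IsoX0 T U
lemma1 T _ n>2 i j i≢j _ sibT U hypo with third-element n>2 i j
... | k , i≢k , j≢k = ExtendAcrossSibling.iso i≢j sibT sibU (hypo i)
  where
  sibU : Siblings U i j
  sibU = siblings-transfer (hypo k) i≢k j≢k sibT
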